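{- Let $S$ be a set of input sequences on three characters $a,b,c$, each with at most three states. Suppose each of the partition intersection graphs $G[a,b]$, $G[b,c]$, $G[a,c]$ has a proper triangulation, and let $C$ be a chordless cycle in $G[a,b,c]$. Then $C$ does not contain all three states of any character.
   Context: The partition intersection graph of $S$ has a vertex for each (character, state) pair, denoted $a_i,b_i,c_i$ for $i\in\{0,1,2\}$, and an edge between states of two different characters iff some sequence of $S$ has both of those states; no edges join states of the same character. The color of a vertex is its character. $G[a,b]$ denotes the subgraph induced on the states of $a$ and $b$, etc., and $G[a,b,c]$ the whole graph. A proper triangulation of a colored graph is a chordal supergraph on the same vertex set in which every edge joins vertices of different colors; a graph is chordal if it has no chordless cycle, where a chordless cycle is a cycle of length at least four in which no two non-consecutive vertices of the cycle are adjacent. -}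

module Defs where

open import Data.Nat using (ℕ; suc; _+_; _≤_)
open import Data.Fin using (Fin; toℕ)
open import Data.Product using (_×_; _,_; proj₁; proj₂; Σ; ∃)
open import Data.Sum using (_⊎_)
open import Data.Unit using (⊤)
open import Data.List using (List)
open import Data.List.Membership.Propositional using (_∈_)
open import Relation.Binary.PropositionalEquality using (_≡_; _≢_)
open import Relation.Nullary using (¬_)
open import Function.Definitions using (Injective)

-- Characters a,b,c are 0,1,2 : Fin 3.  Each character has at most three
-- states, which we label 0,1,2 : Fin 3.
Char : Set
Char = Fin 3

State : Set
State = Fin 3

Seq : Set
Seq = Char → State

Vertex : Set
Vertex = Char × State

color : Vertex → Char
color = proj₁

PIG : List Seq → Vertex → Vertex → Set
PIG S (x , i) (y , j) = x ≢ y × Σ Seq (λ s → s ∈ S × s x ≡ i × s y ≡ j)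

-- Graphs on a vertex subset: a vertex predicate together with an
-- adjacency relation on Vertex (only its restriction to the subset matters).

ConsecDir : ℕ → ℕ → ℕ → Set
ConsecDir n i j = (j ≡ suc i) ⊎ (suc i ≡ n × j ≡ 0)

Consec : ℕ → ℕ → ℕ → Set
Consec n i j = ConsecDir n i j ⊎ ConsecDir n j i

record ChordlessCycle (P : Vertex → Set) (E : Vertex → Vertex → Set) (n : ℕ) : Set where
  field
    len≥4    : 4 ≤ n
    vert     : Fin n → Vertex
    distinct : Injective _≡_ _≡_ vert
    inGraph  : ∀ i → P (vert i)
    edges    : ∀ i j → ConsecDir n (toℕ i) (toℕ j) → E (vert i) (vert j)
    noChord  : ∀ i j → i ≢ j → ¬ Consec n (toℕ i) (toℕ j) → ¬ E (vert i) (vert j)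

Chordal : (Vertex → Set) → (Vertex → Vertex → Set) → Set
Chordal P E = ∀ n → ¬ ChordlessCycle P E n

record ProperTriangulation (P : Vertex → Set) (E : Vertex → Vertex → Set) : Set₁ where
  field
    H          : Vertex → Vertex → Set
    symmetric  : ∀ u v → P u → P v → H u v → H v u
    supergraph : ∀ u v → P u → P v → E u v → H u v
    proper     : ∀ u v → P u → P v → H u v → color u ≢ color v
    chordal    : Chordal P H

OnChars₂ : Char → Char → Vertex → Set
OnChars₂ x y v = color v ≡ x ⊎ color v ≡ y

AllVertices : Vertex → Set
AllVertices _ = ⊤

-- On a chordless cycle through all three states of x, an edge avoiding x would span a triangle with the
-- state of x taken by the sequence witnessing that edge. So every other vertex of the cycle is a state of x,
-- and moving two places along the cycle permutes the three states without fixed points: the cycle is a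
-- hexagon a₀ b₀ a₁ b₁ a₂ b₂ whose aᵢ are the states of x. If the bᵢ all have the same colour y this is an
-- alternating hexagon of G[x,y]; if only one of them has another colour, it can be replaced by the state of y
-- shared by the two sequences witnessing its edges. But a proper triangulation of G[x,y] contains no
-- alternating hexagon: it has no edges between equal colours, so a long chord closes a chordless 4-cycle
-- and without one the hexagon itself is chordless.
module Submission where

open import Defs
open import Data.Nat using (ℕ; suc; _≤_; _<_; _<?_; z≤n; s≤s; _*_; _+_)
open import Data.Nat.Properties using (≤-antisym; ≮⇒≥; <-irrefl; suc-injective; ≤⇒≯)
open import Data.Nat.Tactic.RingSolver using (solve-∀)
open import Data.Fin using (Fin; zero; suc; toℕ; fromℕ<; _≟_; combine; remQuot)
open import Data.Fin.Patterns
open import Data.Fin.Properties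
  using (toℕ-injective; toℕ<n; toℕ-fromℕ<; toℕ-combine; remQuot-combine; combine-remQuot)
open import Data.Product using (_×_; _,_; proj₁; proj₂; Σ; uncurry)
open import Data.Sum using (_⊎_; inj₁; inj₂; [_,_]; swap)
open import Function using (_∘_; id)
open import Data.List using (List)
open import Data.Vec using ([]; _∷_; lookup)
open import Data.Vec.Relation.Unary.All using ([]; _∷_)
open import Data.Vec.Relation.Unary.AllPairs using ([]; _∷_)
open import Data.Vec.Relation.Unary.Unique.Propositional.Properties using (lookup-injective)
open import Data.Empty using (⊥; ⊥-elim)
open import Function.Definitions using (Injective)
open import Relation.Binary.PropositionalEquality
  using (_≡_; _≢_; refl; sym; trans; cong; cong₂; subst; subst₂; module ≡-Reasoning)
open import Relation.Nullary using (¬_; yes; no; contradiction)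
open import Relation.Nullary.Decidable using (True; toWitness)

next : ∀ {n} → Fin n → Fin n
next {suc m} i with suc (toℕ i) <? suc m
... | yes i+1<n = fromℕ< i+1<n
... | no _      = zero

consecDir-next : ∀ {n} (i : Fin n) → ConsecDir n (toℕ i) (toℕ (next i))
consecDir-next {suc m} i with suc (toℕ i) <? suc m
... | yes i+1<n = inj₁ (toℕ-fromℕ< i+1<n)
... | no  i+1≮n = inj₂ (≤-antisym (toℕ<n i) (≮⇒≥ i+1≮n) , refl)

consecDir-functional : ∀ {n a b c} → b < n → c < n → ConsecDir n a b → ConsecDir n a c → b ≡ c
consecDir-functional _   _   (inj₁ refl)       (inj₁ refl)       = refl
consecDir-functional _   _   (inj₂ (_ , refl)) (inj₂ (_ , refl)) = refl
consecDir-functional b<n _   (inj₁ refl)       (inj₂ (a+1≡n , _)) = ⊥-elim (<-irrefl a+1≡n b<n)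
consecDir-functional _   c<n (inj₂ (a+1≡n , _)) (inj₁ refl)      = ⊥-elim (<-irrefl a+1≡n c<n)

consecDir-injective : ∀ {n a a′ b} → ConsecDir n a b → ConsecDir n a′ b → a ≡ a′
consecDir-injective (inj₁ refl)        (inj₁ b≡a′+1)       = suc-injective b≡a′+1
consecDir-injective (inj₂ (a+1≡n , _)) (inj₂ (a′+1≡n , _)) = suc-injective (trans a+1≡n (sym a′+1≡n))
consecDir-injective (inj₁ refl)        (inj₂ (_ , ()))
consecDir-injective (inj₂ (_ , refl))  (inj₁ ())

consecDir⇒≡next : ∀ {n} {i j : Fin n} → ConsecDir n (toℕ i) (toℕ j) → j ≡ next i
consecDir⇒≡next {i = i} {j} d =
  toℕ-injective (consecDir-functional (toℕ<n j) (toℕ<n (next i)) d (consecDir-next i))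

≡next⇒consecDir : ∀ {n} {i j : Fin n} → j ≡ next i → ConsecDir n (toℕ i) (toℕ j)
≡next⇒consecDir {i = i} refl = consecDir-next i

next-injective : ∀ {n} → Injective _≡_ _≡_ (next {n})
next-injective {x = i} {j} e =
  toℕ-injective (consecDir-injective (consecDir-next i) (≡next⇒consecDir e))

-- Used where n has been fixed to a numeral below 4, so that the implicit witness is found by computation.
4≰ : ∀ {n} → 4 ≤ n → {n<4 : True (n <? 4)} → ⊥
4≰ 4≤n {n<4} = ≤⇒≯ 4≤n (toWitness n<4)

no-consecDir-2-cycle : ∀ {n a b} → 4 ≤ n → ConsecDir n a b → ConsecDir n b a → ⊥
no-consecDir-2-cycle _   (inj₁ refl)          (inj₁ ())
no-consecDir-2-cycle 4≤n (inj₁ refl)          (inj₂ (refl , refl)) = 4≰ 4≤n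
no-consecDir-2-cycle 4≤n (inj₂ (refl , refl)) (inj₁ refl)          = 4≰ 4≤n
no-consecDir-2-cycle 4≤n (inj₂ (refl , refl)) (inj₂ (_ , refl))    = 4≰ 4≤n

no-consecDir-3-cycle : ∀ {n a b c} → 4 ≤ n → ConsecDir n a b → ConsecDir n b c → ConsecDir n c a → ⊥
no-consecDir-3-cycle _   (inj₁ refl)          (inj₁ refl)          (inj₁ ())
no-consecDir-3-cycle 4≤n (inj₁ refl)          (inj₁ refl)          (inj₂ (refl , refl)) = 4≰ 4≤n
no-consecDir-3-cycle 4≤n (inj₁ refl)          (inj₂ (refl , refl)) (inj₁ refl)          = 4≰ 4≤n
no-consecDir-3-cycle _   (inj₁ refl)          (inj₂ (refl , refl)) (inj₂ (() , refl))
no-consecDir-3-cycle 4≤n (inj₂ (refl , refl)) (inj₁ refl)          (inj₁ refl)          = 4≰ 4≤n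
no-consecDir-3-cycle _   (inj₂ (refl , refl)) (inj₁ refl)          (inj₂ (() , refl))
no-consecDir-3-cycle _   (inj₂ (refl , refl)) (inj₂ (() , refl))   (inj₁ refl)
no-consecDir-3-cycle 4≤n (inj₂ (refl , refl)) (inj₂ (_ , refl))    (inj₂ (_ , refl))    = 4≰ 4≤n

next²≢id : ∀ {n} → 4 ≤ n → (i : Fin n) → next (next i) ≢ i
next²≢id 4≤n i e = no-consecDir-2-cycle 4≤n (consecDir-next i) (≡next⇒consecDir (sym e))

next³≢id : ∀ {n} → 4 ≤ n → (i : Fin n) → next (next (next i)) ≢ i
next³≢id 4≤n i e =
  no-consecDir-3-cycle 4≤n (consecDir-next i) (consecDir-next (next i)) (≡next⇒consecDir (sym e))

module _ {P : Vertex → Set} {E : Vertex → Vertex → Set} where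

  chordlessCycle : ∀ {n} → 4 ≤ n → (v : Fin n → Vertex) → Injective _≡_ _≡_ v → (∀ i → P (v i))
    → (∀ i → E (v i) (v (next i)))
    → (∀ i j → i ≢ j → j ≢ next i → i ≢ next j → ¬ E (v i) (v j))
    → ChordlessCycle P E n
  chordlessCycle 4≤n v v-injective v∈P edge nonedge = record
    { len≥4    = 4≤n
    ; vert     = v
    ; distinct = v-injective
    ; inGraph  = v∈P
    ; edges    = λ i j d → subst (λ k → E (v i) (v k)) (sym (consecDir⇒≡next d)) (edge i)
    ; noChord  = λ i j i≢j ¬consec → nonedge i j i≢j
                   (λ j≡ → ¬consec (inj₁ (≡next⇒consecDir j≡)))
                   (λ i≡ → ¬consec (inj₂ (≡next⇒consecDir i≡)))
    }

CyclicallyAdjacent : ∀ {n} → Fin n → Fin n → Set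
CyclicallyAdjacent i j = j ≡ next i ⊎ i ≡ next j

no-cyclicallyAdjacent-triangle : ∀ {n} {i j k : Fin n} → 4 ≤ n → i ≢ j → j ≢ k → i ≢ k
  → CyclicallyAdjacent i j → CyclicallyAdjacent j k → CyclicallyAdjacent i k → ⊥
no-cyclicallyAdjacent-triangle _   _   j≢k _   (inj₁ refl) (inj₁ refl) (inj₁ k≡ni) = j≢k (sym k≡ni)
no-cyclicallyAdjacent-triangle 4≤n _   _   _   (inj₁ refl) (inj₁ refl) (inj₂ i≡nk) = next³≢id 4≤n _ (sym i≡nk)
no-cyclicallyAdjacent-triangle _   _   _   i≢k (inj₁ j≡ni) (inj₂ j≡nk) _           = i≢k (next-injective (trans (sym j≡ni) j≡nk))
no-cyclicallyAdjacent-triangle _   _   _   i≢k (inj₂ i≡nj) (inj₁ k≡nj) _           = i≢k (trans i≡nj (sym k≡nj))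
no-cyclicallyAdjacent-triangle 4≤n _   _   _   (inj₂ refl) (inj₂ refl) (inj₁ k≡ni) = next³≢id 4≤n _ (sym k≡ni)
no-cyclicallyAdjacent-triangle _   _   j≢k _   (inj₂ i≡nj) (inj₂ j≡nk) (inj₂ i≡nk) = j≢k (next-injective (trans (sym i≡nj) i≡nk))

module ChordlessCycleProperties {P : Vertex → Set} {E : Vertex → Vertex → Set} {n : ℕ}
                                (C : ChordlessCycle P E n) where
  open ChordlessCycle C

  edge-next : ∀ i → E (vert i) (vert (next i))
  edge-next i = edges i (next i) (consecDir-next i)

  adjacent⇒cyclicallyAdjacent : ∀ {i j} → i ≢ j → E (vert i) (vert j) → CyclicallyAdjacent i j
  adjacent⇒cyclicallyAdjacent {i} {j} i≢j e with j ≟ next i | i ≟ next j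
  ... | yes j≡ | _      = inj₁ j≡
  ... | no  _  | yes i≡ = inj₂ i≡
  ... | no j≢  | no i≢  = ⊥-elim (noChord i j i≢j [ j≢ ∘ consecDir⇒≡next , i≢ ∘ consecDir⇒≡next ] e)

  nonadjacent : ∀ {i j} → i ≢ j → j ≢ next i → i ≢ next j → ¬ E (vert i) (vert j)
  nonadjacent i≢j j≢ni i≢nj e = [ j≢ni , i≢nj ] (adjacent⇒cyclicallyAdjacent i≢j e)

  triangle-free : ∀ {i j k} → i ≢ j → j ≢ k → i ≢ k
    → E (vert i) (vert j) → E (vert j) (vert k) → E (vert i) (vert k) → ⊥
  triangle-free i≢j j≢k i≢k eij ejk eik = no-cyclicallyAdjacent-triangle len≥4 i≢j j≢k i≢k
    (adjacent⇒cyclicallyAdjacent i≢j eij)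
    (adjacent⇒cyclicallyAdjacent j≢k ejk)
    (adjacent⇒cyclicallyAdjacent i≢k eik)

record AlternatingCycle (E : Vertex → Vertex → Set) (c d : Char) (m : ℕ) : Set where
  field
    a b         : Fin m → Vertex
    a-colour    : ∀ p → color (a p) ≡ c
    b-colour    : ∀ p → color (b p) ≡ d
    a-injective : Injective _≡_ _≡_ a
    b-injective : Injective _≡_ _≡_ b
    ab-edge     : ∀ p → E (a p) (b p)
    ba-edge     : ∀ p → E (b p) (a (next p))

next-combine-0 : ∀ {m} (p : Fin m) → next (combine {n = 2} p 0F) ≡ combine p 1F
next-combine-0 {m} p = sym (consecDir⇒≡next
  (subst₂ (ConsecDir (m * 2)) (sym (toℕ-combine p 0F)) (sym (toℕ-combine p 1F))
    (inj₁ (step (toℕ p)))))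
  where
  step : ∀ x → 2 * x + 1 ≡ suc (2 * x + 0)
  step = solve-∀

consecDir-double : ∀ {m x y} → ConsecDir m x y → ConsecDir (m * 2) (2 * x + 1) (2 * y + 0)
consecDir-double {x = x} (inj₁ refl)          = inj₁ (step x)
  where
  step : ∀ x → 2 * suc x + 0 ≡ suc (2 * x + 1)
  step = solve-∀
consecDir-double {x = x} (inj₂ (refl , refl)) = inj₂ (wrap x , refl)
  where
  wrap : ∀ x → suc (2 * x + 1) ≡ suc x * 2
  wrap = solve-∀

next-combine-1 : ∀ {m} (p : Fin m) → next (combine {n = 2} p 1F) ≡ combine (next p) 0F
next-combine-1 {m} p = sym (consecDir⇒≡next
  (subst₂ (ConsecDir (m * 2)) (sym (toℕ-combine p 1F)) (sym (toℕ-combine (next p) 0F))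
    (consecDir-double (consecDir-next p))))

data CombineView (m n : ℕ) : Fin (m * n) → Set where
  combined : (p : Fin m) (s : Fin n) → CombineView m n (combine p s)

combineView : ∀ m n (k : Fin (m * n)) → CombineView m n k
combineView m n k = subst (CombineView m n) (combine-remQuot {m} n k) (combined _ _)

module _ {P : Vertex → Set} {H : Vertex → Vertex → Set}
         (symmetric : ∀ u v → P u → P v → H u v → H v u)
         (proper : ∀ u v → P u → P v → H u v → color u ≢ color v)
         {c d : Char} (onChars⊆P : ∀ {v} → OnChars₂ c d v → P v)
         {m : ℕ} (A : AlternatingCycle H c d m) where
  open AlternatingCycle A

  private
    a∈P : ∀ p → P (a p)
    a∈P p = onChars⊆P (inj₁ (a-colour p))

    b∈P : ∀ p → P (b p)
    b∈P p = onChars⊆P (inj₂ (b-colour p))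

    c≢d : Fin m → c ≢ d
    c≢d p c≡d = proper _ _ (a∈P p) (b∈P p) (ab-edge p)
      (trans (a-colour p) (trans c≡d (sym (b-colour p))))

    side : Fin 2 → Fin m → Vertex
    side 0F = a
    side 1F = b

    side∈P : ∀ s p → P (side s p)
    side∈P 0F = a∈P
    side∈P 1F = b∈P

    sideColour : Fin 2 → Char
    sideColour 0F = c
    sideColour 1F = d

    side-colour : ∀ s p → color (side s p) ≡ sideColour s
    side-colour 0F = a-colour
    side-colour 1F = b-colour

    vertex : Fin (m * 2) → Vertex
    vertex k = side (proj₂ (remQuot {m} 2 k)) (proj₁ (remQuot {m} 2 k))

    vertex-combine : ∀ p s → vertex (combine p s) ≡ side s p
    vertex-combine p s = cong (λ r → side (proj₂ r) (proj₁ r)) (remQuot-combine p s)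

    side-injective : ∀ {s t p q} → side s p ≡ side t q → _≡_ {A = Fin m × Fin 2} (p , s) (q , t)
    side-injective {0F} {0F} e = cong (_, 0F) (a-injective e)
    side-injective {1F} {1F} e = cong (_, 1F) (b-injective e)
    side-injective {0F} {1F} {p} e =
      ⊥-elim (c≢d p (trans (sym (a-colour _)) (trans (cong proj₁ e) (b-colour _))))
    side-injective {1F} {0F} {p} e =
      ⊥-elim (c≢d p (trans (sym (a-colour _)) (trans (cong proj₁ (sym e)) (b-colour _))))

    vertex-injective : Injective _≡_ _≡_ vertex
    vertex-injective {k} {l} e = begin
      k                                  ≡⟨ combine-remQuot {m} 2 k ⟨
      uncurry combine (remQuot {m} 2 k)  ≡⟨ cong (uncurry combine) (side-injective e) ⟩
      uncurry combine (remQuot {m} 2 l)  ≡⟨ combine-remQuot {m} 2 l ⟩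
      l                                  ∎
      where open ≡-Reasoning

    vertex∈P : ∀ k → P (vertex k)
    vertex∈P k = side∈P (proj₂ (remQuot {m} 2 k)) (proj₁ (remQuot {m} 2 k))

    side-edge : ∀ (p : Fin m) s → H (side s p) (vertex (next (combine p s)))
    side-edge p 0F rewrite next-combine-0 p | vertex-combine p 1F        = ab-edge p
    side-edge p 1F rewrite next-combine-1 p | vertex-combine (next p) 0F = ba-edge p

    vertex-edge : ∀ k → H (vertex k) (vertex (next k))
    vertex-edge k with combineView m 2 k
    ... | combined p s = subst (λ u → H u (vertex (next (combine p s)))) (sym (vertex-combine p s)) (side-edge p s)

  alternatingCycle⇒chordlessCycle : 4 ≤ m * 2 → (∀ p q → q ≢ p → p ≢ next q → ¬ H (a p) (b q))
    → ChordlessCycle P H (m * 2)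
  alternatingCycle⇒chordlessCycle 4≤2m no-chord =
    chordlessCycle 4≤2m vertex vertex-injective vertex∈P vertex-edge nonedge
    where
    nonedge : ∀ i j → i ≢ j → j ≢ next i → i ≢ next j → ¬ H (vertex i) (vertex j)
    nonedge i j _ j≢ni i≢nj with combineView m 2 i | combineView m 2 j
    ... | combined p s | combined q t =
      subst₂ (λ u v → ¬ H u v) (sym (vertex-combine p s)) (sym (vertex-combine q t)) (side-nonedge s t j≢ni i≢nj)
      where
      same-side : ∀ s → ¬ H (side s p) (side s q)
      same-side s h =
        proper _ _ (side∈P s p) (side∈P s q) h (trans (side-colour s p) (sym (side-colour s q)))

      side-nonedge : ∀ s t → combine q t ≢ next (combine p s) → combine p s ≢ next (combine q t)
        → ¬ H (side s p) (side t q)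
      side-nonedge 0F 0F _ _ = same-side 0F
      side-nonedge 1F 1F _ _ = same-side 1F
      side-nonedge 0F 1F j≢ni i≢nj = no-chord p q
        (λ { refl → j≢ni (sym (next-combine-0 q)) })
        (λ { refl → i≢nj (sym (next-combine-1 q)) })
      side-nonedge 1F 0F j≢ni i≢nj h = no-chord q p
        (λ { refl → i≢nj (sym (next-combine-0 p)) })
        (λ { refl → j≢ni (sym (next-combine-1 p)) })
        (symmetric _ _ (b∈P p) (a∈P q) h)

Fin2-≡next : ∀ {p q : Fin 2} → q ≢ p → p ≡ next q
Fin2-≡next {0F} {0F} q≢p = ⊥-elim (q≢p refl)
Fin2-≡next {0F} {1F} _   = refl
Fin2-≡next {1F} {0F} _   = refl
Fin2-≡next {1F} {1F} q≢p = ⊥-elim (q≢p refl)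

Fin3-next≢id : ∀ (p : Fin 3) → next p ≢ p
Fin3-next≢id 0F ()
Fin3-next≢id 1F ()
Fin3-next≢id 2F ()

Fin3-next²≢id : ∀ (p : Fin 3) → next (next p) ≢ p
Fin3-next²≢id 0F ()
Fin3-next²≢id 1F ()
Fin3-next²≢id 2F ()

Fin3-≡next : ∀ {p q : Fin 3} → q ≢ p → p ≢ next q → q ≡ next p
Fin3-≡next {0F} {0F} q≢p _    = ⊥-elim (q≢p refl)
Fin3-≡next {0F} {1F} _    _    = refl
Fin3-≡next {0F} {2F} _    p≢nq = ⊥-elim (p≢nq refl)
Fin3-≡next {1F} {0F} _    p≢nq = ⊥-elim (p≢nq refl)
Fin3-≡next {1F} {1F} q≢p _    = ⊥-elim (q≢p refl)
Fin3-≡next {1F} {2F} _    _    = refl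
Fin3-≡next {2F} {0F} _    _    = refl
Fin3-≡next {2F} {1F} _    p≢nq = ⊥-elim (p≢nq refl)
Fin3-≡next {2F} {2F} q≢p _    = ⊥-elim (q≢p refl)

mapAlternatingCycle : ∀ {E E′ c d m} → (∀ {u v} → OnChars₂ c d u → OnChars₂ c d v → E u v → E′ u v)
  → AlternatingCycle E c d m → AlternatingCycle E′ c d m
mapAlternatingCycle E⊆E′ A = record
  { a = a ; b = b ; a-colour = a-colour ; b-colour = b-colour
  ; a-injective = a-injective ; b-injective = b-injective
  ; ab-edge = λ p → E⊆E′ (inj₁ (a-colour p)) (inj₂ (b-colour p)) (ab-edge p)
  ; ba-edge = λ p → E⊆E′ (inj₂ (b-colour p)) (inj₁ (a-colour (next p))) (ba-edge p)
  }
  where open AlternatingCycle A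

alternatingSquare : ∀ {H c d} → (∀ {u v} → OnChars₂ c d u → OnChars₂ c d v → H u v → H v u)
  → (A : AlternatingCycle H c d 3) (p : Fin 3)
  → H (AlternatingCycle.a A p) (AlternatingCycle.b A (next p)) → AlternatingCycle H c d 2
alternatingSquare {H} H-sym A p chord = record
  { a = a ∘ along ; b = b ∘ along
  ; a-colour = a-colour ∘ along ; b-colour = b-colour ∘ along
  ; a-injective = along-injective ∘ a-injective ; b-injective = along-injective ∘ b-injective
  ; ab-edge = ab-edge ∘ along
  ; ba-edge = λ { 0F → ba-edge p ; 1F → H-sym (inj₁ (a-colour p)) (inj₂ (b-colour (next p))) chord }
  }
  where
  open AlternatingCycle A
  along : Fin 2 → Fin 3
  along 0F = p
  along 1F = next p
  along-injective : Injective _≡_ _≡_ along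
  along-injective {0F} {0F} _ = refl
  along-injective {0F} {1F} e = ⊥-elim (Fin3-next≢id p (sym e))
  along-injective {1F} {0F} e = ⊥-elim (Fin3-next≢id p e)
  along-injective {1F} {1F} _ = refl

triangulation⇒no-alternatingHexagon : ∀ {P E c d} → ProperTriangulation P E → (∀ {v} → OnChars₂ c d v → P v)
  → ¬ AlternatingCycle E c d 3
triangulation⇒no-alternatingHexagon {P} {E} {c} {d} T onChars⊆P A =
  chordal 6 (hexagon λ p q q≢p p≢nq → subst (λ r → ¬ H (a p) (b r)) (sym (Fin3-≡next q≢p p≢nq)) (no-long-chord p))
  where
  open ProperTriangulation T
  H-sym : ∀ {u v} → OnChars₂ c d u → OnChars₂ c d v → H u v → H v u
  H-sym u∈ v∈ = symmetric _ _ (onChars⊆P u∈) (onChars⊆P v∈)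
  A′ : AlternatingCycle H c d 3
  A′ = mapAlternatingCycle (λ u∈ v∈ → supergraph _ _ (onChars⊆P u∈) (onChars⊆P v∈)) A
  open AlternatingCycle A′
  hexagon : (∀ p q → q ≢ p → p ≢ next q → ¬ H (a p) (b q)) → ChordlessCycle P H 6
  hexagon = alternatingCycle⇒chordlessCycle symmetric proper onChars⊆P A′ (s≤s (s≤s (s≤s (s≤s z≤n))))
  no-long-chord : ∀ p → ¬ H (a p) (b (next p))
  no-long-chord p chord = chordal 4
    (alternatingCycle⇒chordlessCycle symmetric proper onChars⊆P (alternatingSquare H-sym A′ p chord)
      (s≤s (s≤s (s≤s (s≤s z≤n)))) λ _ _ q≢p p≢nq → ⊥-elim (p≢nq (Fin2-≡next q≢p)))

Fin3-derangement-cycle : (σ : Fin 3 → Fin 3) → Injective _≡_ _≡_ σ → (∀ i → σ i ≢ i)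
  → σ (σ 0F) ≢ 0F × σ (σ (σ 0F)) ≡ 0F
Fin3-derangement-cycle σ σ-injective σ-fpf with σ 0F in e₀ | σ 1F in e₁ | σ 2F in e₂
... | 0F | _  | _  = ⊥-elim (σ-fpf 0F e₀)
... | _  | 1F | _  = ⊥-elim (σ-fpf 1F e₁)
... | _  | _  | 2F = ⊥-elim (σ-fpf 2F e₂)
... | 1F | 2F | 0F rewrite e₁ | e₂ = (λ ()) , refl
... | 2F | 0F | 1F rewrite e₂ | e₁ = (λ ()) , refl
... | 1F | 0F | 0F = contradiction (σ-injective (trans e₁ (sym e₂))) λ ()
... | 1F | 0F | 1F = contradiction (σ-injective (trans e₀ (sym e₂))) λ ()
... | 1F | 2F | 1F = contradiction (σ-injective (trans e₀ (sym e₂))) λ ()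
... | 2F | 0F | 0F = contradiction (σ-injective (trans e₁ (sym e₂))) λ ()
... | 2F | 2F | 0F = contradiction (σ-injective (trans e₀ (sym e₁))) λ ()
... | 2F | 2F | 1F = contradiction (σ-injective (trans e₀ (sym e₁))) λ ()

Fin3-third-unique : ∀ {p q r s : Fin 3} → p ≢ q → r ≢ p → r ≢ q → s ≢ p → s ≢ q → r ≡ s
Fin3-third-unique {0F} {0F} p≢q _ _ _ _ = ⊥-elim (p≢q refl)
Fin3-third-unique {1F} {1F} p≢q _ _ _ _ = ⊥-elim (p≢q refl)
Fin3-third-unique {2F} {2F} p≢q _ _ _ _ = ⊥-elim (p≢q refl)
Fin3-third-unique {r = 0F} {0F} _ _ _ _ _ = refl
Fin3-third-unique {r = 1F} {1F} _ _ _ _ _ = refl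
Fin3-third-unique {r = 2F} {2F} _ _ _ _ _ = refl
Fin3-third-unique {0F} {r = 0F} _ r≢p _ _ _ = ⊥-elim (r≢p refl)
Fin3-third-unique {1F} {r = 1F} _ r≢p _ _ _ = ⊥-elim (r≢p refl)
Fin3-third-unique {2F} {r = 2F} _ r≢p _ _ _ = ⊥-elim (r≢p refl)
Fin3-third-unique {q = 0F} {r = 0F} _ _ r≢q _ _ = ⊥-elim (r≢q refl)
Fin3-third-unique {q = 1F} {r = 1F} _ _ r≢q _ _ = ⊥-elim (r≢q refl)
Fin3-third-unique {q = 2F} {r = 2F} _ _ r≢q _ _ = ⊥-elim (r≢q refl)
Fin3-third-unique {0F} {s = 0F} _ _ _ s≢p _ = ⊥-elim (s≢p refl)
Fin3-third-unique {1F} {s = 1F} _ _ _ s≢p _ = ⊥-elim (s≢p refl)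
Fin3-third-unique {2F} {s = 2F} _ _ _ s≢p _ = ⊥-elim (s≢p refl)
Fin3-third-unique {q = 0F} {s = 0F} _ _ _ _ s≢q = ⊥-elim (s≢q refl)
Fin3-third-unique {q = 1F} {s = 1F} _ _ _ _ s≢q = ⊥-elim (s≢q refl)
Fin3-third-unique {q = 2F} {s = 2F} _ _ _ _ s≢q = ⊥-elim (s≢q refl)

PIG-symmetric : ∀ {S u v} → PIG S u v → PIG S v u
PIG-symmetric (u≢v , s , s∈S , su , sv) = u≢v ∘ sym , s , s∈S , sv , su

PIG-commonNeighbour : ∀ {S u v} y → PIG S u v → color u ≢ y → color v ≢ y
  → Σ State λ j → PIG S (y , j) u × PIG S (y , j) v
PIG-commonNeighbour y (_ , s , s∈S , su , sv) u≢y v≢y =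
  s y , (u≢y ∘ sym , s , s∈S , refl , su) , (v≢y ∘ sym , s , s∈S , refl , sv)

record InducedHexagon (S : List Seq) (x : Char) : Set where
  field
    a b         : Fin 3 → Vertex
    a-colour    : ∀ p → color (a p) ≡ x
    a-injective : Injective _≡_ _≡_ a
    b-injective : Injective _≡_ _≡_ b
    ab-edge     : ∀ p → PIG S (a p) (b p)
    ba-edge     : ∀ p → PIG S (b p) (a (next p))
    ab-nonedge  : ∀ p → ¬ PIG S (a p) (b (next p))
    bb-nonedge  : ∀ p q → p ≢ q → ¬ PIG S (b p) (b q)

module CycleThroughAllStates {S : List Seq} {n : ℕ} (C : ChordlessCycle AllVertices (PIG S) n) {x : Char}
       (occurs : ∀ (i : State) → Σ (Fin n) (λ k → ChordlessCycle.vert C k ≡ (x , i))) where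
  open ChordlessCycle C
  open ChordlessCycleProperties C

  private
    colour : Fin n → Char
    colour k = color (vert k)

    ≢-colour : ∀ {i j} → colour i ≢ colour j → i ≢ j
    ≢-colour ne i≡j = ne (cong colour i≡j)

    pos : State → Fin n
    pos i = proj₁ (occurs i)

    vert-pos : ∀ i → vert (pos i) ≡ (x , i)
    vert-pos i = proj₂ (occurs i)

    pos-colour : ∀ i → colour (pos i) ≡ x
    pos-colour i = cong proj₁ (vert-pos i)

    pos-injective : Injective _≡_ _≡_ pos
    pos-injective {i} {j} e = cong proj₂ (trans (sym (vert-pos i)) (trans (cong vert e) (vert-pos j)))

    edge-colour : ∀ k → colour k ≢ colour (next k)
    edge-colour k = proj₁ (edge-next k)

    edge-meets-colour : ∀ k → colour k ≡ x ⊎ colour (next k) ≡ x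
    edge-meets-colour k with colour k ≟ x | colour (next k) ≟ x
    ... | yes k≡x | _        = inj₁ k≡x
    ... | no _    | yes nk≡x = inj₂ nk≡x
    ... | no k≢x  | no nk≢x  with PIG-commonNeighbour x (edge-next k) k≢x nk≢x
    ...   | i , t~k , t~nk = ⊥-elim (triangle-free (≢-colour t≢k) (≢-colour (edge-colour k)) (≢-colour t≢nk)
                               (subst (λ v → PIG S v (vert k)) (sym (vert-pos i)) t~k)
                               (edge-next k)
                               (subst (λ v → PIG S v (vert (next k))) (sym (vert-pos i)) t~nk))
      where
      t≢k : colour (pos i) ≢ colour k
      t≢k e = k≢x (trans (sym e) (pos-colour i))
      t≢nk : colour (pos i) ≢ colour (next k)
      t≢nk e = nk≢x (trans (sym e) (pos-colour i))

    colour-next≢x : ∀ {k} → colour k ≡ x → colour (next k) ≢ x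
    colour-next≢x {k} k≡x nk≡x = edge-colour k (trans k≡x (sym nk≡x))

    colour-next² : ∀ {k} → colour k ≡ x → colour (next (next k)) ≡ x
    colour-next² {k} k≡x with edge-meets-colour (next k)
    ... | inj₁ nk≡x  = ⊥-elim (colour-next≢x k≡x nk≡x)
    ... | inj₂ nnk≡x = nnk≡x

    σ : State → State
    σ i = proj₂ (vert (next (next (pos i))))

    pos-σ : ∀ i → pos (σ i) ≡ next (next (pos i))
    pos-σ i = distinct (trans (vert-pos (σ i)) (cong (_, σ i) (sym (colour-next² (pos-colour i)))))

    σ-injective : Injective _≡_ _≡_ σ
    σ-injective {i} {j} e = pos-injective (next-injective (next-injective
      (trans (sym (pos-σ i)) (trans (cong pos e) (pos-σ j)))))

    σ-fixpointFree : ∀ i → σ i ≢ i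
    σ-fixpointFree i e = next²≢id len≥4 (pos i) (trans (sym (pos-σ i)) (cong pos e))

    σ-cycle : σ (σ 0F) ≢ 0F × σ (σ (σ 0F)) ≡ 0F
    σ-cycle = Fin3-derangement-cycle σ σ-injective σ-fixpointFree

    orbit : Fin 3 → State
    orbit = lookup (0F ∷ σ 0F ∷ σ (σ 0F) ∷ [])

    orbit-injective : Injective _≡_ _≡_ orbit
    orbit-injective = lookup-injective
      ( (σ-fixpointFree 0F ∘ sym ∷ proj₁ σ-cycle ∘ sym ∷ [])
      ∷ (σ-fixpointFree (σ 0F) ∘ sym ∷ [])
      ∷ [] ∷ []) _ _

    σ-orbit : ∀ p → σ (orbit p) ≡ orbit (next p)
    σ-orbit 0F = refl
    σ-orbit 1F = refl
    σ-orbit 2F = proj₂ σ-cycle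

    A : Fin 3 → Fin n
    A = pos ∘ orbit

    A-next : ∀ p → next (next (A p)) ≡ A (next p)
    A-next p = trans (sym (pos-σ (orbit p))) (cong pos (σ-orbit p))

    A-injective : Injective _≡_ _≡_ A
    A-injective = orbit-injective ∘ pos-injective

    A-colour : ∀ p → colour (A p) ≡ x
    A-colour p = pos-colour (orbit p)

    A≢next-A : ∀ p q → A p ≢ next (A q)
    A≢next-A p q e = colour-next≢x (A-colour q) (trans (cong colour (sym e)) (A-colour p))

  inducedHexagon : InducedHexagon S x
  inducedHexagon = record
    { a = vert ∘ A
    ; b = vert ∘ next ∘ A
    ; a-colour = A-colour
    ; a-injective = A-injective ∘ distinct
    ; b-injective = A-injective ∘ next-injective ∘ distinct
    ; ab-edge = edge-next ∘ A
    ; ba-edge = λ p → subst (PIG S (vert (next (A p))) ∘ vert) (A-next p) (edge-next (next (A p)))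
    ; ab-nonedge = λ p → nonadjacent (A≢next-A p (next p))
        (Fin3-next≢id p ∘ A-injective ∘ next-injective)
        (λ e → Fin3-next²≢id p (A-injective (sym (trans e (A-next (next p))))))
    ; bb-nonedge = λ p q p≢q → nonadjacent (p≢q ∘ A-injective ∘ next-injective)
        (λ e → A≢next-A (next p) q (sym (trans e (A-next p))))
        (λ e → A≢next-A (next q) p (sym (trans e (A-next q))))
    }

rotate : ∀ {S x} → InducedHexagon S x → InducedHexagon S x
rotate h = record
  { a = a ∘ next ; b = b ∘ next ; a-colour = a-colour ∘ next
  ; a-injective = next-injective ∘ a-injective ; b-injective = next-injective ∘ b-injective
  ; ab-edge = ab-edge ∘ next ; ba-edge = ba-edge ∘ next ; ab-nonedge = ab-nonedge ∘ next
  ; bb-nonedge = λ p q p≢q → bb-nonedge (next p) (next q) (p≢q ∘ next-injective)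
  }
  where open InducedHexagon h

module _ {S : List Seq} {x y : Char} (h : InducedHexagon S x) where
  open InducedHexagon h

  monochromatic : (∀ p → color (b p) ≡ y) → AlternatingCycle (PIG S) x y 3
  monochromatic b-colour = record
    { a = a ; b = b ; a-colour = a-colour ; b-colour = b-colour
    ; a-injective = a-injective ; b-injective = b-injective ; ab-edge = ab-edge ; ba-edge = ba-edge }

  a≢b-colour : ∀ p q → color (a p) ≢ color (b q)
  a≢b-colour p q e = proj₁ (ab-edge q) (trans (a-colour q) (trans (sym (a-colour p)) e))

  -- Both edges at b 2F are witnessed by sequences whose state of y avoids the states of b 0F and b 1F
  -- (by the non-edges of h); since y has three states, these two states agree.
  oddOneOut : color (b 0F) ≡ y → color (b 1F) ≡ y → color (b 2F) ≢ y → AlternatingCycle (PIG S) x y 3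
  oddOneOut b₀-colour b₁-colour b₂≢y
    with PIG-commonNeighbour y (ab-edge 2F) (a≢y 2F) b₂≢y | PIG-commonNeighbour y (ba-edge 2F) b₂≢y (a≢y 0F)
    where
    a≢y : ∀ p → color (a p) ≢ y
    a≢y p e = a≢b-colour p 0F (trans e (sym b₀-colour))
  ... | j , w~a₂ , w~b₂ | j′ , w′~b₂ , w′~a₀ = record
    { a = a ; b = lookup (b 0F ∷ b 1F ∷ (y , j) ∷ []) ; a-colour = a-colour
    ; b-colour = λ { 0F → b₀-colour ; 1F → b₁-colour ; 2F → refl }
    ; a-injective = a-injective
    ; b-injective = lookup-injective ((b₀≢b₁ ∷ w≢b₀ ∘ sym ∷ []) ∷ (w≢b₁ ∘ sym ∷ []) ∷ [] ∷ []) _ _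
    ; ab-edge = λ { 0F → ab-edge 0F ; 1F → ab-edge 1F ; 2F → PIG-symmetric w~a₂ }
    ; ba-edge = λ { 0F → ba-edge 0F ; 1F → ba-edge 1F
                  ; 2F → subst (λ i → PIG S (y , i) (a 0F)) (sym j≡j′) w′~a₀ }
    }
    where
    b₀≢b₁ : b 0F ≢ b 1F
    b₀≢b₁ e with () ← b-injective e
    is-b₀ : ∀ {i} → i ≡ proj₂ (b 0F) → (y , i) ≡ b 0F
    is-b₀ = cong₂ _,_ (sym b₀-colour)
    is-b₁ : ∀ {i} → i ≡ proj₂ (b 1F) → (y , i) ≡ b 1F
    is-b₁ = cong₂ _,_ (sym b₁-colour)
    w≢b₀ : (y , j) ≢ b 0F
    w≢b₀ e = ab-nonedge 2F (subst (PIG S (a 2F)) e (PIG-symmetric w~a₂))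
    w≢b₁ : (y , j) ≢ b 1F
    w≢b₁ e = bb-nonedge 1F 2F (λ ()) (subst (λ v → PIG S v (b 2F)) e w~b₂)
    w′≢b₀ : (y , j′) ≢ b 0F
    w′≢b₀ e = bb-nonedge 0F 2F (λ ()) (subst (λ v → PIG S v (b 2F)) e w′~b₂)
    w′≢b₁ : (y , j′) ≢ b 1F
    w′≢b₁ e = ab-nonedge 0F (subst (PIG S (a 0F)) e (PIG-symmetric w′~a₀))
    j≡j′ : j ≡ j′
    j≡j′ = Fin3-third-unique (b₀≢b₁ ∘ trans (sym (is-b₀ refl)) ∘ is-b₁)
      (w≢b₀ ∘ is-b₀) (w≢b₁ ∘ is-b₁) (w′≢b₀ ∘ is-b₀) (w′≢b₁ ∘ is-b₁)

inducedHexagon-absurd : ∀ {S x y z} → InducedHexagon S x → y ≢ z → (∀ c → c ≢ x → c ≡ y ⊎ c ≡ z)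
  → ¬ AlternatingCycle (PIG S) x y 3 → ¬ AlternatingCycle (PIG S) x z 3 → ⊥
inducedHexagon-absurd {S} {x} {y} {z} h y≢z other no-y no-z
  with b-colour 0F | b-colour 1F | b-colour 2F
  where
  open InducedHexagon h
  b-colour : ∀ p → color (b p) ≡ y ⊎ color (b p) ≡ z
  b-colour p = other _ λ e → proj₁ (ab-edge p) (trans (a-colour p) (sym e))
... | inj₁ p | inj₁ q | inj₁ r = no-y (monochromatic h λ { 0F → p ; 1F → q ; 2F → r })
... | inj₂ p | inj₂ q | inj₂ r = no-z (monochromatic h λ { 0F → p ; 1F → q ; 2F → r })
... | inj₁ p | inj₁ q | inj₂ r = no-y (oddOneOut h p q λ e → y≢z (trans (sym e) r))
... | inj₂ p | inj₂ q | inj₁ r = no-z (oddOneOut h p q λ e → y≢z (trans (sym r) e))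
... | inj₂ p | inj₁ q | inj₁ r = no-y (oddOneOut (rotate h) q r λ e → y≢z (trans (sym e) p))
... | inj₁ p | inj₂ q | inj₂ r = no-z (oddOneOut (rotate h) q r λ e → y≢z (trans (sym p) e))
... | inj₁ p | inj₂ q | inj₁ r = no-y (oddOneOut (rotate (rotate h)) r p λ e → y≢z (trans (sym e) q))
... | inj₂ p | inj₁ q | inj₂ r = no-z (oddOneOut (rotate (rotate h)) r p λ e → y≢z (trans (sym q) e))

lemma1 : (S : List Seq)
    → ProperTriangulation (OnChars₂ zero (suc zero)) (PIG S)
    → ProperTriangulation (OnChars₂ (suc zero) (suc (suc zero))) (PIG S)
    → ProperTriangulation (OnChars₂ zero (suc (suc zero))) (PIG S)
    → (n : ℕ) (C : ChordlessCycle AllVertices (PIG S) n)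
    → (x : Char)
    → ¬ (∀ (i : State) → Σ (Fin n) (λ k → ChordlessCycle.vert C k ≡ (x , i)))
lemma1 S T₀₁ T₁₂ T₀₂ n C x occurs = excluded x (CycleThroughAllStates.inducedHexagon C occurs)
  where
  excluded : ∀ x → InducedHexagon S x → ⊥
  excluded 0F h = inducedHexagon-absurd h (λ ())
    (λ { 0F 0≢0 → ⊥-elim (0≢0 refl) ; 1F _ → inj₁ refl ; 2F _ → inj₂ refl })
    (triangulation⇒no-alternatingHexagon T₀₁ id) (triangulation⇒no-alternatingHexagon T₀₂ id)
  excluded 1F h = inducedHexagon-absurd h (λ ())
    (λ { 0F _ → inj₁ refl ; 1F 1≢1 → ⊥-elim (1≢1 refl) ; 2F _ → inj₂ refl })
    (triangulation⇒no-alternatingHexagon T₀₁ swap) (triangulation⇒no-alternatingHexagon T₁₂ id)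
  excluded 2F h = inducedHexagon-absurd h (λ ())
    (λ { 0F _ → inj₁ refl ; 1F _ → inj₂ refl ; 2F 2≢2 → ⊥-elim (2≢2 refl) })
    (triangulation⇒no-alternatingHexagon T₀₂ swap) (triangulation⇒no-alternatingHexagon T₁₂ swap)
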